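{- Let $\mathcal S\in\Sigma^n$ be a string and $\pi:[n]\to[n]$ an order-preserving permutation for $\mathcal S$. For any right-maximal substring $\alpha$ of $\mathcal S$ and any character $a$ such that $\alpha a$ occurs in $\mathcal S$, define $\pi(\alpha a)=\min\{\pi(i-1): \mathcal S[1,i]\text{ has suffix }\alpha a\}$. Then, for any two distinct characters $a\neq b$ such that $\alpha a$ and $\alpha b$ occur in $\mathcal S$ and $\pi(\alpha a)<\pi(\alpha b)$, there exists $t\in\mathrm{PDA}_\pi$ such that $\mathcal S[1,t]$ has suffix $\alpha b$.
   Context: Strings are 1-indexed, $\mathcal S[i,j]=\mathcal S[i]\cdots\mathcal S[j]$. A substring $\alpha$ of $\mathcal S$ is right-maximal if it is a suffix of $\mathcal S$ or there exist distinct $a,b\in\Sigma$ with $\alpha a$ and $\alpha b$ both substrings of $\mathcal S$. For $i\neq j$, $\mathrm{rlce}(i,j)$ is the length of the longest common prefix of $\mathcal S[i,n]$ and $\mathcal S[j,n]$. A permutation $\pi$ of $[n]$ is order-preserving for $\mathcal S$ if for all $i,j\in[n-1]$, $\pi(i)<\pi(j)$ and $\mathcal S[i,i+1]=\mathcal S[j,j+1]$ imply $\pi(i+1)<\pi(j+1)$. $\mathrm{LPF}_\pi[i]=0$ if $\pi(i)=1$, else $\mathrm{LPF}_\pi[i]=\max_{j:\pi(j)<\pi(i)}\mathrm{rlce}(j,i)$. The path decomposition array $\mathrm{PDA}_\pi$ is the set $\{i+\mathrm{LPF}_\pi[i]: i\in[n]\}$, sorted by colexicographic order of the prefixes $\mathcal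 S[1,j]$. -}

module Defs where

open import Data.Nat using (ℕ; zero; suc; _+_; _∸_; _≤_; _<_; _⊔_; _<ᵇ_; _≡ᵇ_)
open import Data.Bool using (if_then_else_)
open import Data.List using (List; []; _∷_; _++_; [_]; take; drop; length; foldr; upTo; map)
open import Data.Product using (Σ; ∃; ∃-syntax; _×_; _,_)
open import Data.Sum using (_⊎_)
open import Relation.Binary.PropositionalEquality using (_≡_; _≢_)
open import Relation.Binary.Definitions using (DecidableEquality)
open import Relation.Nullary using (yes; no)

-- Strings are lists; positions are 1-indexed natural numbers, n = length S.

IsSuffix : {A : Set} → List A → List A → Set
IsSuffix w u = ∃[ v ] (v ++ w ≡ u)

Occurs : {A : Set} → List A → List A → Set
Occurs w u = ∃[ p ] ∃[ q ] (p ++ w ++ q ≡ u)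

module _ {Σc : Set} (_≟_ : DecidableEquality Σc) where

  pre : List Σc → ℕ → List Σc
  pre S i = take i S

  -- S[i,j]  (for 1 ≤ i ≤ j ≤ n)
  sub : List Σc → ℕ → ℕ → List Σc
  sub S i j = take (suc j ∸ i) (drop (i ∸ 1) S)

  InRange : ℕ → ℕ → Set
  InRange n i = 1 ≤ i × i ≤ n

  RightMaximal : List Σc → List Σc → Set
  RightMaximal S α =
    IsSuffix α S ⊎ (∃[ a ] ∃[ b ] (a ≢ b × Occurs (α ++ [ a ]) S × Occurs (α ++ [ b ]) S))

  lcp : List Σc → List Σc → ℕ
  lcp (x ∷ xs) (y ∷ ys) with x ≟ y
  ... | yes _ = suc (lcp xs ys)
  ... | no _  = 0
  lcp _ _ = 0

  rlce : List Σc → ℕ → ℕ → ℕ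
  rlce S i j = lcp (drop (i ∸ 1) S) (drop (j ∸ 1) S)

  -- π is a permutation of [n] (π given as a map ℕ → ℕ, only its values on [n] matter)
  IsPermutation : ℕ → (ℕ → ℕ) → Set
  IsPermutation n π =
    (∀ i → InRange n i → InRange n (π i)) ×
    (∀ i j → InRange n i → InRange n j → π i ≡ π j → i ≡ j) ×
    (∀ k → InRange n k → ∃[ i ] (InRange n i × π i ≡ k))

  OrderPreserving : List Σc → (ℕ → ℕ) → Set
  OrderPreserving S π =
    ∀ i j → InRange (length S ∸ 1) i → InRange (length S ∸ 1) j →
      π i < π j → sub S i (suc i) ≡ sub S j (suc j) → π (suc i) < π (suc j)

  range1 : ℕ → List ℕ
  range1 n = map suc (upTo n)

  LPF : List Σc → (ℕ → ℕ) → ℕ → ℕ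
  LPF S π i =
    if π i ≡ᵇ 1 then 0
    else foldr (λ j acc → if π j <ᵇ π i then rlce S j i ⊔ acc else acc) 0 (range1 (length S))

  -- membership in PDA_π = { i + LPF_π[i] : i ∈ [n] }  (the sorting is irrelevant for membership)
  InPDA : List Σc → (ℕ → ℕ) → ℕ → Set
  InPDA S π t = ∃[ i ] (InRange (length S) i × t ≡ i + LPF S π i)

  -- positions i (with i-1 ∈ [n], i.e. 2 ≤ i ≤ n) such that S[1,i] has suffix α c
  OccEnd : List Σc → List Σc → Σc → ℕ → Set
  OccEnd S α c i = 2 ≤ i × i ≤ length S × IsSuffix (α ++ [ c ]) (pre S i)

  IsPiOf : List Σc → (ℕ → ℕ) → List Σc → Σc → ℕ → Set
  IsPiOf S π α c m =
    (∃[ i ] (OccEnd S α c i × π (i ∸ 1) ≡ m)) ×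
    (∀ i → OccEnd S α c i → m ≤ π (i ∸ 1))

{-# OPTIONS --safe #-}
-- Take the occurrence of α b whose starting position p is ranked first by π.
-- No suffix ranked before p can share α b with it, so LPF_π[p] ≤ |α|.
-- Conversely, let α a occur at q with π-minimal last α-position.  If π ranked
-- q after p, order preservation would carry this order along the common
-- prefix α, ranking the last α-position of the α b occurrence before that of
-- the α a occurrence, against π(α a) < π(α b); and q = p would force a = b.
-- So q is ranked before p and shares α with it: LPF_π[p] = |α|, whence
-- t = p + |α| ∈ PDA_π and S[1,t] ends with α b.
module Submission where

open import Defs
open import Data.Bool using (Bool; true; false; if_then_else_; T)
open import Data.Empty using (⊥-elim)
open import Data.List using (List; []; _∷_; _++_; [_]; length; take; drop; foldr; upTo; filter)
open import Data.List.Extrema.Nat using (argmin; argmin-all; f[argmin]≤f[xs])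
open import Data.List.Membership.Propositional using (_∈_)
open import Data.List.Membership.Propositional.Properties using (∈-filter⁺; ∈-upTo⁺; ∈-map⁺; ∈-map⁻)
open import Data.List.Properties
  using (++-assoc; ++-cancelˡ; ++-identityʳ; ∷-injectiveˡ; ∷-injectiveʳ; length-++; length-++-sucʳ;
         length-++-≤ˡ; length-take; take++drop≡id)
open import Data.List.Relation.Unary.All using (lookup)
open import Data.List.Relation.Unary.All.Properties using (all-filter)
open import Data.List.Relation.Unary.Any using (here; there)
open import Data.Nat using (ℕ; zero; suc; _+_; _∸_; _≤_; _<_; _⊔_; _⊓_; _<ᵇ_; _≡ᵇ_; z≤n; s≤s; s≤s⁻¹)
open import Data.Nat.Properties
  using (≤-trans; ≤-reflexive; ≤-antisym; <-≤-trans; <-asym; <-cmp; ≤⇒≯; <⇒≱; ≮⇒≥; ⊔-lub;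
         m≤m⊔n; m≤n⊔m; m≤n+m; m+n≤o⇒m≤o; m+n≤o⇒m≤o∸n; m+n∸n≡m; m≤n⇒m⊓n≡m; +-suc; +-comm;
         suc-injective; <ᵇ⇒<; <⇒<ᵇ; ≡ᵇ⇒≡)
open import Data.Product using (∃-syntax; _×_; _,_; proj₁; proj₂; map₂; uncurry)
open import Data.Unit using (tt)
open import Function using (_∘_)
open import Relation.Binary.Definitions using (DecidableEquality; tri<; tri≈; tri>)
open import Relation.Binary.PropositionalEquality hiding ([_])
open import Relation.Nullary using (Dec; yes; no; contradiction)
open import Relation.Nullary.Decidable using (map′; _×-dec_)
open import Relation.Unary using (Decidable)

module _ {A : Set} {P : A → Set} (P? : Decidable P) (f : A → ℕ) where

  ∃-argmin : (xs : List A) → (∀ {z} → P z → z ∈ xs) → ∀ {x} → P x →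
             ∃[ y ] (P y × (∀ {z} → P z → f y ≤ f z))
  ∃-argmin xs complete {x} px =
    y , argmin-all f px (all-filter P? xs) ,
    λ pz → lookup (f[argmin]≤f[xs] {f = f} x candidates) (∈-filter⁺ P? (complete pz) pz)
    where
    candidates : List A
    candidates = filter P? xs
    y : A
    y = argmin f x candidates

-- Off the case π p ≡ 1, LPF S π p unfolds to
-- guardedMax (λ j → π j <ᵇ π p) (λ j → rlce S j p) (range1 (length S)).
guardedMax : (ℕ → Bool) → (ℕ → ℕ) → List ℕ → ℕ
guardedMax keep h = foldr (λ j acc → if keep j then h j ⊔ acc else acc) 0

module _ (keep : ℕ → Bool) (h : ℕ → ℕ) where

  guardedMax-lub : ∀ {k} xs → (∀ {j} → j ∈ xs → T (keep j) → h j ≤ k) →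
                   guardedMax keep h xs ≤ k
  guardedMax-lub []       _     = z≤n
  guardedMax-lub (j ∷ xs) bound with keep j in kept
  ... | true  =
    ⊔-lub (bound (here refl) (subst T (sym kept) tt)) (guardedMax-lub xs (bound ∘ there))
  ... | false = guardedMax-lub xs (bound ∘ there)

  guardedMax-upper : ∀ {j} xs → j ∈ xs → T (keep j) → h j ≤ guardedMax keep h xs
  guardedMax-upper (x ∷ xs) (here refl) kept with keep x
  ... | true  = m≤m⊔n (h x) _
  ... | false = ⊥-elim kept
  guardedMax-upper (x ∷ xs) (there j∈xs) kept with keep x
  ... | true  = ≤-trans (guardedMax-upper xs j∈xs kept) (m≤n⊔m (h x) _)
  ... | false = guardedMax-upper xs j∈xs kept

module Occurrences {A : Set} (_≟_ : DecidableEquality A) where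

  length≤lcp : ∀ α (x y : List A) → length α ≤ lcp _≟_ (α ++ x) (α ++ y)
  length≤lcp []      _ _ = z≤n
  length≤lcp (c ∷ α) x y with c ≟ c
  ... | yes _   = s≤s (length≤lcp α x y)
  ... | no c≢c = contradiction refl c≢c

  length<lcp⇒extension : ∀ α {c r} xs → length α < lcp _≟_ xs (α ++ c ∷ r) →
                         ∃[ r′ ] (xs ≡ α ++ c ∷ r′)
  length<lcp⇒extension []      {c} (x ∷ xs) agree with x ≟ c
  ... | yes refl = xs , refl
  length<lcp⇒extension []          (x ∷ xs) ()    | no _
  length<lcp⇒extension (y ∷ α)     (x ∷ xs) agree with x ≟ y
  ... | yes refl = map₂ (cong (x ∷_)) (length<lcp⇒extension α xs (s≤s⁻¹ agree))
  length<lcp⇒extension (y ∷ α)     (x ∷ xs) ()    | no _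
  length<lcp⇒extension []          []       ()
  length<lcp⇒extension (_ ∷ _)     []       ()

  extension? : ∀ α c xs → Dec (∃[ r ] (xs ≡ α ++ c ∷ r))
  extension? []      c []       = no λ { (_ , ()) }
  extension? []      c (x ∷ xs) =
    map′ (λ x≡c → xs , cong (_∷ xs) x≡c) (∷-injectiveˡ ∘ proj₂) (x ≟ c)
  extension? (y ∷ α) c []       = no λ { (_ , ()) }
  extension? (y ∷ α) c (x ∷ xs) =
    map′ (λ (x≡y , r , e) → r , cong₂ _∷_ x≡y e)
         (λ (r , e) → ∷-injectiveˡ e , r , ∷-injectiveʳ e)
         (x ≟ y ×-dec extension? α c xs)

  -- α c occurs in S starting at the 1-indexed position suc d.
  record OccursAt (S α : List A) (c : A) (d : ℕ) : Set where
    constructor occurs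
    field
      rest   : List A
      starts : drop d S ≡ α ++ c ∷ rest

  EndsAt : List A → List A → ℕ → Set
  EndsAt S w i = i ≤ length S × IsSuffix w (take i S)

  occursAt? : ∀ S α c → Decidable (OccursAt S α c)
  occursAt? S α c d =
    map′ (λ (r , e) → occurs r e) (λ (occurs r e) → r , e) (extension? α c (drop d S))

  extension-unique : ∀ {S α a b d} → OccursAt S α a d → OccursAt S α b d → a ≡ b
  extension-unique {α = α} (occurs _ eqa) (occurs _ eqb) =
    ∷-injectiveˡ (++-cancelˡ α _ _ (trans (sym eqa) eqb))

  occursAt-tail : ∀ S {c β a} d → OccursAt S (c ∷ β) a d → OccursAt S β a (suc d)
  occursAt-tail (_ ∷ _) zero    (occurs r refl) = occurs r refl
  occursAt-tail (_ ∷ S) (suc d) (occurs r eq) with occursAt-tail S d (occurs r eq)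
  ... | occurs r′ eq′ = occurs r′ eq′

  occursAt-adjacent : ∀ {S c c′ β a d} → OccursAt S (c ∷ c′ ∷ β) a d → OccursAt S [ c ] c′ d
  occursAt-adjacent (occurs r eq) = occurs _ eq

  take-extension : ∀ α {c} (r : List A) → take (suc (length α)) (α ++ c ∷ r) ≡ α ++ [ c ]
  take-extension []      _ = refl
  take-extension (x ∷ α) r = cong (x ∷_) (take-extension α r)

  occursAt⇒endsAt : ∀ S {α c} d → OccursAt S α c d → EndsAt S (α ++ [ c ]) (suc d + length α)
  occursAt⇒endsAt S       {α} {c} zero (occurs r refl) =
    ≤-trans (s≤s (length-++-≤ˡ α)) (≤-reflexive (sym (length-++-sucʳ α c r))) ,
    [] , sym (take-extension α r)
  occursAt⇒endsAt (x ∷ S) (suc d) (occurs r eq) with occursAt⇒endsAt S d (occurs r eq)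
  ... | fits , v , e = s≤s fits , x ∷ v , cong (x ∷_) e
  occursAt⇒endsAt []      {[]}    (suc d) (occurs _ ())
  occursAt⇒endsAt []      {_ ∷ _} (suc d) (occurs _ ())

  drop-length-++ : ∀ (v w : List A) → drop (length v) (v ++ w) ≡ w
  drop-length-++ []      w = refl
  drop-length-++ (_ ∷ v) w = drop-length-++ v w

  endsAt⇒occursAt : ∀ S {α c i} → EndsAt S (α ++ [ c ]) i →
                    ∃[ d ] (OccursAt S α c d × suc d + length α ≡ i)
  endsAt⇒occursAt S {α} {c} {i} (i≤n , v , e) = length v , occurs (drop i S) starts , ends
    where
    open ≡-Reasoning
    splits : v ++ α ++ c ∷ drop i S ≡ S
    splits = begin
      v ++ α ++ c ∷ drop i S         ≡⟨ cong (v ++_) (++-assoc α [ c ] (drop i S)) ⟨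
      v ++ (α ++ [ c ]) ++ drop i S  ≡⟨ ++-assoc v (α ++ [ c ]) (drop i S) ⟨
      (v ++ α ++ [ c ]) ++ drop i S  ≡⟨ cong (_++ drop i S) e ⟩
      take i S ++ drop i S           ≡⟨ take++drop≡id i S ⟩
      S                              ∎
    starts : drop (length v) S ≡ α ++ c ∷ drop i S
    starts = subst (λ T → drop (length v) T ≡ α ++ c ∷ drop i S) splits
                   (drop-length-++ v (α ++ c ∷ drop i S))
    ends : suc (length v) + length α ≡ i
    ends = begin
      suc (length v + length α)          ≡⟨ +-suc (length v) (length α) ⟨
      length v + suc (length α)          ≡⟨ cong (λ u → length v + suc (length u)) (++-identityʳ α) ⟨
      length v + suc (length (α ++ []))  ≡⟨ cong (length v +_) (length-++-sucʳ α c []) ⟨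
      length v + length (α ++ [ c ])     ≡⟨ length-++ v ⟨
      length (v ++ α ++ [ c ])           ≡⟨ cong length e ⟩
      length (take i S)                  ≡⟨ length-take i S ⟩
      i ⊓ length S                       ≡⟨ m≤n⇒m⊓n≡m i≤n ⟩
      i                                  ∎

  start-inRange : ∀ {S α c d} → OccursAt S α c d → InRange _≟_ (length S) (suc d)
  start-inRange {S} {d = d} occ =
    s≤s z≤n , m+n≤o⇒m≤o (suc d) (proj₁ (occursAt⇒endsAt S d occ))

  length≤rlce : ∀ {S α a b d e} → OccursAt S α a d → OccursAt S α b e →
                length α ≤ rlce _≟_ S (suc d) (suc e)
  length≤rlce {α = α} (occurs _ eqd) (occurs _ eqe) =
    subst₂ (λ xs ys → length α ≤ lcp _≟_ xs ys) (sym eqd) (sym eqe) (length≤lcp α _ _)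

  length<rlce⇒occursAt : ∀ {S α b d} j → OccursAt S α b d →
                         length α < rlce _≟_ S (suc j) (suc d) → OccursAt S α b j
  length<rlce⇒occursAt {S} {α} j (occurs r eqd) longer =
    uncurry occurs (length<lcp⇒extension α (drop j S)
                      (subst (λ xs → length α < lcp _≟_ (drop j S) xs) eqd longer))

  sub-adjacent : ∀ {S c c′ d} → OccursAt S [ c ] c′ d →
                 sub _≟_ S (suc d) (suc (suc d)) ≡ c ∷ c′ ∷ []
  sub-adjacent {d = d} (occurs _ eq) = cong₂ take (m+n∸n≡m 2 d) eq

  adjacent-inRange : ∀ {S c c′ d} → OccursAt S [ c ] c′ d → InRange _≟_ (length S ∸ 1) (suc d)
  adjacent-inRange {S} {d = d} occ =
    s≤s z≤n , m+n≤o⇒m≤o∸n (suc d) (proj₁ (occursAt⇒endsAt S d occ))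

module Ranking {A : Set} (_≟_ : DecidableEquality A) (S : List A) (π : ℕ → ℕ) where

  open Occurrences _≟_

  LPF-lub : ∀ {p k} → (∀ j → π (suc j) < π p → rlce _≟_ S (suc j) p ≤ k) → LPF _≟_ S π p ≤ k
  LPF-lub {p} {k} bound with π p ≡ᵇ 1
  ... | true  = z≤n
  ... | false =
    guardedMax-lub (λ j → π j <ᵇ π p) (λ j → rlce _≟_ S j p) (range1 _≟_ (length S)) ranked-bound
    where
    ranked-bound : ∀ {j} → j ∈ range1 _≟_ (length S) → T (π j <ᵇ π p) → rlce _≟_ S j p ≤ k
    ranked-bound j∈ ranked with ∈-map⁻ suc j∈
    ... | j , _ , refl = bound j (<ᵇ⇒< _ _ ranked)

  rlce≤LPF : IsPermutation _≟_ (length S) π → ∀ {j p} → InRange _≟_ (length S) j → π j < π p →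
             rlce _≟_ S j p ≤ LPF _≟_ S π p
  rlce≤LPF (inRange , _) {suc j} {p} j∈[n]@(_ , j≤n) ranked with π p ≡ᵇ 1 in πp≡ᵇ1
  ... | true  =
    ⊥-elim (≤⇒≯ (proj₁ (inRange (suc j) j∈[n])) (subst (π (suc j) <_) πp≡1 ranked))
    where
    πp≡1 : π p ≡ 1
    πp≡1 = ≡ᵇ⇒≡ (π p) 1 (subst T (sym πp≡ᵇ1) tt)
  ... | false = guardedMax-upper (λ j → π j <ᵇ π p) (λ j → rlce _≟_ S j p) (range1 _≟_ (length S))
                  (∈-map⁺ suc (∈-upTo⁺ j≤n)) (<⇒<ᵇ ranked)

  starts<⇒ends< : OrderPreserving _≟_ S π → ∀ c β {a b d e} →
                           OccursAt S (c ∷ β) a d → OccursAt S (c ∷ β) b e → π (suc d) < π (suc e) →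
                           π (d + length (c ∷ β)) < π (e + length (c ∷ β))
  starts<⇒ends< _  c []       {d = d} {e} _    _    ranked =
    subst₂ (λ i j → π i < π j) (+-comm 1 d) (+-comm 1 e) ranked
  starts<⇒ends< op c (c′ ∷ β) {a} {b} {d} {e} occd occe ranked =
    subst₂ (λ i j → π i < π j) (sym (+-suc d (suc (length β)))) (sym (+-suc e (suc (length β))))
      (starts<⇒ends< op c′ β (occursAt-tail S d occd) (occursAt-tail S e occe)
        (op (suc d) (suc e) (adjacent-inRange adjd) (adjacent-inRange adje) ranked
            (trans (sub-adjacent adjd) (sym (sub-adjacent adje)))))
    where
    adjd : OccursAt S [ c ] c′ d
    adjd = occursAt-adjacent occd
    adje : OccursAt S [ c ] c′ e
    adje = occursAt-adjacent occe

  ends<⇒starts< : IsPermutation _≟_ (length S) π → OrderPreserving _≟_ S π →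
                   ∀ c β {a b d e} → a ≢ b → OccursAt S (c ∷ β) a d → OccursAt S (c ∷ β) b e →
                   π (d + length (c ∷ β)) < π (e + length (c ∷ β)) → π (suc d) < π (suc e)
  ends<⇒starts< (_ , injective , _) op c β {d = d} {e} a≢b occa occb ends<
    with <-cmp (π (suc d)) (π (suc e))
  ... | tri< starts< _ _ = starts<
  ... | tri≈ _ starts≡ _ =
    contradiction (extension-unique occa (subst (OccursAt S (c ∷ β) _) (sym d≡e) occb)) a≢b
    where
    d≡e : d ≡ e
    d≡e = suc-injective
            (injective (suc d) (suc e) (start-inRange occa) (start-inRange occb) starts≡)
  ... | tri> _ _ starts> = contradiction (starts<⇒ends< op c β occb occa starts>) (<-asym ends<)

  piOf-witness : ∀ {α c m} → IsPiOf _≟_ S π α c m →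
                 ∃[ d ] (OccursAt S α c d × π (d + length α) ≡ m)
  piOf-witness ((i , (_ , endsAt) , πi≡m) , _) with endsAt⇒occursAt S endsAt
  ... | d , occ , refl = d , occ , πi≡m

  piOf-minimal : ∀ {c β a m d} → IsPiOf _≟_ S π (c ∷ β) a m → OccursAt S (c ∷ β) a d →
                   m ≤ π (d + length (c ∷ β))
  piOf-minimal {β = β} {d = d} (_ , minimal) occ =
    minimal (suc d + suc (length β)) (s≤s (≤-trans (s≤s z≤n) (m≤n+m _ d)) , occursAt⇒endsAt S d occ)

  FirstOccurrence : List A → A → ℕ → Set
  FirstOccurrence α c d = OccursAt S α c d × (∀ {e} → OccursAt S α c e → π (suc d) ≤ π (suc e))

  first-occurrence : ∀ {α c d} → OccursAt S α c d → ∃[ d′ ] FirstOccurrence α c d′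
  first-occurrence {α} {c} =
    ∃-argmin (occursAt? S α c) (π ∘ suc) (upTo (length S)) (∈-upTo⁺ ∘ proj₂ ∘ start-inRange)

  LPF≤length : ∀ {α b d} → FirstOccurrence α b d → LPF _≟_ S π (suc d) ≤ length α
  LPF≤length (occ , first) =
    LPF-lub λ j ranked → ≮⇒≥ λ longer → <⇒≱ ranked (first (length<rlce⇒occursAt j occ longer))

  length≤LPF : IsPermutation _≟_ (length S) π → OrderPreserving _≟_ S π →
               ∀ α {a b ma mb d} → a ≢ b → IsPiOf _≟_ S π α a ma → IsPiOf _≟_ S π α b mb → ma < mb →
               OccursAt S α b d → length α ≤ LPF _≟_ S π (suc d)
  length≤LPF _    _  []      _   _  _  _     _    = z≤n
  length≤LPF perm op (c ∷ β) {d = d} a≢b πa πb ma<mb occb with piOf-witness πa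
  ... | da , occa , πa≡ma =
    ≤-trans (length≤rlce occa occb)
            (rlce≤LPF perm (start-inRange occa) (ends<⇒starts< perm op c β a≢b occa occb ends<))
    where
    ends< : π (da + length (c ∷ β)) < π (d + length (c ∷ β))
    ends< = subst (_< _) (sym πa≡ma) (<-≤-trans ma<mb (piOf-minimal πb occb))

lemma15 : {Σc : Set} (_≟_ : DecidableEquality Σc) (S : List Σc) (π : ℕ → ℕ) →
    IsPermutation _≟_ (length S) π → OrderPreserving _≟_ S π →
    (α : List Σc) → RightMaximal _≟_ S α →
    (a b : Σc) → a ≢ b → Occurs (α ++ [ a ]) S → Occurs (α ++ [ b ]) S →
    (ma mb : ℕ) → IsPiOf _≟_ S π α a ma → IsPiOf _≟_ S π α b mb → ma < mb →
    ∃[ t ] (InPDA _≟_ S π t × t ≤ length S × IsSuffix (α ++ [ b ]) (pre _≟_ S t))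
lemma15 _≟_ S π perm op α _ a b a≢b _ _ ma mb πa πb ma<mb =
  suc d + LPF _≟_ S π (suc d) , (suc d , start-inRange occ , refl) ,
  subst (EndsAt S (α ++ [ b ])) (cong (suc d +_) (sym LPF≡length)) (occursAt⇒endsAt S d occ)
  where
  open Occurrences _≟_
  open Ranking _≟_ S π
  first : ∃[ d ] FirstOccurrence α b d
  first = first-occurrence (proj₁ (proj₂ (piOf-witness πb)))
  d : ℕ
  d = proj₁ first
  occ : OccursAt S α b d
  occ = proj₁ (proj₂ first)
  LPF≡length : LPF _≟_ S π (suc d) ≡ length α
  LPF≡length = ≤-antisym (LPF≤length (proj₂ first)) (length≤LPF perm op α a≢b πa πb ma<mb occ)
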